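{- Let $x\in\mathsf{Pop}_{\mathrm{Tam}(A_{n-1})}(\mathrm{Tam}(A_{n-1}))$. Then there exists $y=y_1\cdots y_n\in\mathrm{Tam}(A_{n-1})$ with $y_n=1$ and $\mathsf{Pop}_{\mathrm{Tam}(A_{n-1})}(y)=x$.
   Context: $\mathrm{Tam}(A_{n-1})$ is the set of $312$-avoiding permutations of $\{1,\dots,n\}$ (no $i<j<k$ with $y_j<y_k<y_i$), ordered by the order induced from the right weak order on $S_n$ ($x\le y$ iff every pair of values $a<b$ with $b$ before $a$ in $x$ also has $b$ before $a$ in $y$); it is a lattice (the Tamari lattice). For a finite lattice $M$, $\mathsf{Pop}_M(x)$ is the meet in $M$ of $x$ together with all elements covered by $x$; $\mathsf{Pop}_M(M)$ is its image. -}

module Defs where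

open import Data.Nat using (ℕ)
open import Data.Fin using (Fin; _<_)
open import Data.Vec using (Vec; lookup)
open import Data.Product using (Σ; ∃; _×_)
open import Data.Sum using (_⊎_)
open import Relation.Nullary using (¬_)
open import Relation.Binary.PropositionalEquality using (_≡_)

-- A word y = y₁⋯yₙ over {1,…,n}, encoded 0-based: value k+1 is (k : Fin n),
-- position i+1 is (i : Fin n).
Word : ℕ → Set
Word n = Vec (Fin n) n

IsPerm : ∀ {n} → Word n → Set
IsPerm {n} y = ∀ (i j : Fin n) → lookup y i ≡ lookup y j → i ≡ j

Avoids312 : ∀ {n} → Word n → Set
Avoids312 {n} y = ¬ (Σ (Fin n) λ i → Σ (Fin n) λ j → Σ (Fin n) λ k →
  i < j × j < k × lookup y j < lookup y k × lookup y k < lookup y i)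

Tam : ∀ {n} → Word n → Set
Tam y = IsPerm y × Avoids312 y

Inv : ∀ {n} → Word n → Fin n → Fin n → Set
Inv {n} y a b = a < b × (Σ (Fin n) λ i → Σ (Fin n) λ j →
  i < j × lookup y i ≡ b × lookup y j ≡ a)

_≤W_ : ∀ {n} → Word n → Word n → Set
_≤W_ {n} x y = ∀ (a b : Fin n) → Inv x a b → Inv y a b

_⋖T_ : ∀ {n} → Word n → Word n → Set
_⋖T_ {n} x y = Tam x × Tam y × x ≤W y × ¬ (x ≡ y) ×
  (∀ (z : Word n) → Tam z → x ≤W z → z ≤W y → z ≡ x ⊎ z ≡ y)

IsMeetT : ∀ {n} → (Word n → Set) → Word n → Set
IsMeetT {n} S m = Tam m × (∀ (s : Word n) → S s → m ≤W s) ×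
  (∀ (w : Word n) → Tam w → (∀ (s : Word n) → S s → w ≤W s) → w ≤W m)

PopSet : ∀ {n} → Word n → Word n → Set
PopSet y s = s ≡ y ⊎ s ⋖T y

IsPop : ∀ {n} → Word n → Word n → Set
IsPop y x = IsMeetT (PopSet y) x

-- Encode a 312-avoiding permutation w by its bracket e: e a is the largest b such that (a, b)
-- is an inversion of w, or a itself. The inversions of w are exactly the pairs a < b ≤ e a,
-- the brackets of 312-avoiding permutations are exactly the nested functions with a ≤ e a < n,
-- and the weak order becomes the pointwise order of brackets. The elements covered by y arise by
-- lowering a single value e a to pop e a, the largest v < e a such that [a, v] is closed under e;
-- hence the common lower bounds of y and its lower covers are the permutations whose bracket lies
-- below pop e, i.e. Pop(y) has bracket pop e.
-- Given Pop(z) = x, raise the bracket e of z to n − 1 at every a for which [0, a) is closed under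
-- pop e. This leaves pop e unchanged, and e 0 = n − 1 says that the letter 1 comes last.

module Submission where

open import Defs
open import Data.Nat
open import Data.Nat.Properties
open import Algebra.Properties.CommutativeSemigroup +-commutativeSemigroup using (x∙yz≈y∙xz)
open import Data.Fin as F using (Fin; zero; fromℕ; toℕ; fromℕ<; punchOut)
open import Data.Fin.Properties as FP
  using (toℕ<n; toℕ-fromℕ<; fromℕ<-toℕ; toℕ-fromℕ; toℕ-injective; any?; pigeonhole; punchOut-injective)
open import Data.Fin.Induction using (<-wellFounded)
open import Data.Vec using (Vec; lookup; tabulate)
open import Data.Vec.Properties using (lookup∘tabulate; tabulate∘lookup; tabulate-cong)
open import Data.Product using (Σ; _×_; _,_; proj₁; proj₂)
open import Data.Sum using (_⊎_; inj₁; inj₂; map₂; [_,_]′)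
open import Data.Empty using (⊥; ⊥-elim)
open import Function.Bundles using (_⇔_; mk⇔; Equivalence)
open import Function.Construct.Composition using (_⇔-∘_)
open import Function.Construct.Symmetry using (⇔-sym)
open import Induction.WellFounded using (module All)
open import Level using (0ℓ)
open import Relation.Binary.Definitions using (tri<; tri≈; tri>)
open import Relation.Binary.PropositionalEquality
open import Relation.Nullary using (¬_; Dec; yes; no; contradiction)
open import Relation.Nullary.Decidable using (map′; toSum; _×-dec_; _→-dec_)
open import Relation.Unary using (Decidable)

-- Counting and bounded search in ℕ

∀<-weaken : {X : ℕ → Set} {k : ℕ} → (∀ i → i < suc k → X i) → ∀ i → i < k → X i
∀<-weaken h i i<k = h i (m≤n⇒m≤1+n i<k)

∀<-extend : {X : ℕ → Set} {k : ℕ} → (∀ i → i < k → X i) → X k → ∀ i → i < suc k → X i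
∀<-extend h x i i<sk with m≤n⇒m<n∨m≡n (s≤s⁻¹ i<sk)
... | inj₁ i<k = h i i<k
... | inj₂ refl = x

count : {P : ℕ → Set} → Decidable P → ℕ → ℕ
count P? zero = 0
count P? (suc k) with P? k
... | yes _ = suc (count P? k)
... | no _ = count P? k

module _ {P : ℕ → Set} (P? : Decidable P) where

  count-≤ : ∀ k → count P? k ≤ k
  count-≤ zero = z≤n
  count-≤ (suc k) with P? k
  ... | yes _ = s≤s (count-≤ k)
  ... | no _ = m≤n⇒m≤1+n (count-≤ k)

  count-≤-suc : ∀ k → count P? k ≤ count P? (suc k)
  count-≤-suc k with P? k
  ... | yes _ = n≤1+n _
  ... | no _ = ≤-refl

  count-atLeast : ∀ lo k → (∀ i → P i → lo ≤ i) → (∀ i → lo ≤ i → P i) → count P? k ≡ k ∸ lo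
  count-atLeast lo zero _ _ = sym (0∸n≡0 lo)
  count-atLeast lo (suc k) sound complete with P? k
  ... | yes p = trans (cong suc (count-atLeast lo k sound complete)) (sym (+-∸-assoc 1 (sound k p)))
  ... | no ¬p = begin
    count P? k  ≡⟨ count-atLeast lo k sound complete ⟩
    k ∸ lo      ≡⟨ m≤n⇒m∸n≡0 (m≤n⇒m≤1+n k<lo) ⟩
    0           ≡⟨ m≤n⇒m∸n≡0 k<lo ⟨
    suc k ∸ lo  ∎
    where
    open ≡-Reasoning
    k<lo : k < lo
    k<lo = ≰⇒> (λ lo≤k → ¬p (complete k lo≤k))

module _ {P Q : ℕ → Set} (P? : Decidable P) (Q? : Decidable Q) where

  count-mono : ∀ k → (∀ i → i < k → P i → Q i) → count P? k ≤ count Q? k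
  count-mono zero _ = z≤n
  count-mono (suc k) P⊆Q with count-mono k (∀<-weaken P⊆Q) | P? k | Q? k
  ... | ih | yes p | no ¬q = contradiction (P⊆Q k ≤-refl p) ¬q
  ... | ih | yes _ | yes _ = s≤s ih
  ... | ih | no _ | yes _ = m≤n⇒m≤1+n ih
  ... | ih | no _ | no _ = ih

count-cong : {P Q : ℕ → Set} (P? : Decidable P) (Q? : Decidable Q) → ∀ k →
  (∀ i → i < k → P i → Q i) → (∀ i → i < k → Q i → P i) → count P? k ≡ count Q? k
count-cong P? Q? k P⊆Q Q⊆P = ≤-antisym (count-mono P? Q? k P⊆Q) (count-mono Q? P? k Q⊆P)

module _ {P Q : ℕ → Set} (P? : Decidable P) (Q? : Decidable Q) where

  count-restrict : ∀ a b → a ≤ b → (∀ i → P i → i < a × Q i) → (∀ i → i < a → Q i → P i) →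
    count P? b ≡ count Q? a
  count-restrict a b a≤b sound complete with m≤n⇒∃[o]m+o≡n a≤b
  ... | d , refl = go d
    where
    go : ∀ d → count P? (a + d) ≡ count Q? a
    go zero rewrite +-identityʳ a = count-cong P? Q? a (λ i _ p → proj₂ (sound i p)) complete
    go (suc d) rewrite +-suc a d with P? (a + d)
    ... | yes p = contradiction (proj₁ (sound _ p)) (<⇒≱ (s≤s (m≤m+n a d)))
    ... | no _ = go d

module _ {P Q R : ℕ → Set} (P? : Decidable P) (Q? : Decidable Q) (R? : Decidable R) where

  count-⊆-∪ : ∀ k → (∀ i → i < k → R i → P i ⊎ Q i) → count R? k ≤ count P? k + count Q? k
  count-⊆-∪ zero _ = z≤n
  count-⊆-∪ (suc k) R⊆P∪Q with count-⊆-∪ k (∀<-weaken R⊆P∪Q) | R? k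
  ... | ih | no _ = ≤-trans ih (+-mono-≤ (count-≤-suc P? k) (count-≤-suc Q? k))
  ... | ih | yes r with R⊆P∪Q k ≤-refl r | P? k | Q? k
  ... | inj₁ p | no ¬p | _ = contradiction p ¬p
  ... | inj₂ q | _ | no ¬q = contradiction q ¬q
  ... | inj₁ _ | yes _ | no _ = s≤s ih
  ... | inj₂ _ | no _ | yes _ = ≤-trans (s≤s ih) (≤-reflexive (sym (+-suc (count P? k) (count Q? k))))
  ... | _ | yes _ | yes _ = s≤s (≤-trans ih (+-monoʳ-≤ (count P? k) (n≤1+n _)))

  count-disjoint-∪ : ∀ k → (∀ i → i < k → P i → Q i → ⊥) → (∀ i → i < k → P i ⊎ Q i → R i) →
    count P? k + count Q? k ≤ count R? k
  count-disjoint-∪ zero _ _ = z≤n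
  count-disjoint-∪ (suc k) disj P∪Q⊆R
    with count-disjoint-∪ k (∀<-weaken disj) (∀<-weaken P∪Q⊆R) | P? k | Q? k | R? k
  ... | _ | yes p | yes q | _ = ⊥-elim (disj k ≤-refl p q)
  ... | _ | yes p | _ | no ¬r = contradiction (P∪Q⊆R k ≤-refl (inj₁ p)) ¬r
  ... | _ | _ | yes q | no ¬r = contradiction (P∪Q⊆R k ≤-refl (inj₂ q)) ¬r
  ... | ih | yes _ | no _ | yes _ = s≤s ih
  ... | ih | no _ | yes _ | yes _ = ≤-trans (≤-reflexive (+-suc _ _)) (s≤s ih)
  ... | ih | no _ | no _ | yes _ = m≤n⇒m≤1+n ih
  ... | ih | no _ | no _ | no _ = ih

lastCounterexample : {Q : ℕ → Set} → Decidable Q → ∀ k → ¬ (∀ a → a < k → Q a) →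
  Σ ℕ λ a → a < k × ¬ Q a × (∀ b → a < b → b < k → Q b)
lastCounterexample Q? zero ¬all = ⊥-elim (¬all (λ _ ()))
lastCounterexample Q? (suc k) ¬all with Q? k
... | no ¬q = k , ≤-refl , ¬q , (λ b k<b b<sk → contradiction (s≤s⁻¹ b<sk) (<⇒≱ k<b))
... | yes q with lastCounterexample Q? k (λ all → ¬all (∀<-extend all q))
... | a , a<k , ¬qa , above = a , m≤n⇒m≤1+n a<k , ¬qa ,
  λ b a<b b<sk → ∀<-extend (λ i i<k a<i → above i a<i i<k) (λ _ → q) b b<sk a<b

greatestBetween : {P : ℕ → Set} → Decidable P → ℕ → ℕ → ℕ
greatestBetween P? a zero = a
greatestBetween P? a (suc b) with (a <? b) ×-dec P? b
... | yes _ = b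
... | no _ = greatestBetween P? a b

module _ {P : ℕ → Set} (P? : Decidable P) (a : ℕ) where

  greatestBetween-≥ : ∀ b → a ≤ greatestBetween P? a b
  greatestBetween-≥ zero = ≤-refl
  greatestBetween-≥ (suc b) with (a <? b) ×-dec P? b
  ... | yes (a<b , _) = <⇒≤ a<b
  ... | no _ = greatestBetween-≥ b

  greatestBetween-found : ∀ b →
    greatestBetween P? a b ≡ a ⊎ (greatestBetween P? a b < b × P (greatestBetween P? a b))
  greatestBetween-found zero = inj₁ refl
  greatestBetween-found (suc b) with (a <? b) ×-dec P? b | greatestBetween-found b
  ... | yes (_ , p) | _ = inj₂ (≤-refl , p)
  ... | no _ | inj₁ eq = inj₁ eq
  ... | no _ | inj₂ (g<b , p) = inj₂ (m≤n⇒m≤1+n g<b , p)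

  greatestBetween-maximal : ∀ b v → a < v → v < b → P v → v ≤ greatestBetween P? a b
  greatestBetween-maximal (suc b) v a<v v<sb p with (a <? b) ×-dec P? b
  ... | yes _ = s≤s⁻¹ v<sb
  ... | no ¬ab with m≤n⇒m<n∨m≡n (s≤s⁻¹ v<sb)
  ...   | inj₁ v<b = greatestBetween-maximal b v a<v v<b p
  ...   | inj₂ refl = contradiction (a<v , p) ¬ab

-- The pop of a function ℕ → ℕ

Closed : (ℕ → ℕ) → ℕ → ℕ → Set
Closed e a v = ∀ m → a < m → m ≤ v → e m ≤ v

closed? : ∀ e a → Decidable (Closed e a)
closed? e a v = map′ (λ h m a<m m≤v → h {m} (s≤s m≤v) a<m) (λ h {m} m<sv a<m → h m a<m (s≤s⁻¹ m<sv))
  (allUpTo? (λ m → (a <? m) →-dec (e m ≤? v)) (suc v))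

closed-refl : ∀ e a → Closed e a a
closed-refl e a m a<m m≤a = contradiction m≤a (<⇒≱ a<m)

pop : (ℕ → ℕ) → ℕ → ℕ
pop e a = greatestBetween (closed? e a) a (e a)

module _ (e : ℕ → ℕ) (a : ℕ) where

  pop-≥ : a ≤ pop e a
  pop-≥ = greatestBetween-≥ (closed? e a) a (e a)

  pop-range : pop e a ≡ a ⊎ pop e a < e a
  pop-range with greatestBetween-found (closed? e a) a (e a)
  ... | inj₁ eq = inj₁ eq
  ... | inj₂ (lt , _) = inj₂ lt

  pop-closed : Closed e a (pop e a)
  pop-closed with greatestBetween-found (closed? e a) a (e a)
  ... | inj₁ eq = subst (Closed e a) (sym eq) (closed-refl e a)
  ... | inj₂ (_ , closed) = closed

  pop-maximal : ∀ u → a ≤ u → u < e a → Closed e a u → u ≤ pop e a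
  pop-maximal u a≤u u<ea closed with m≤n⇒m<n∨m≡n a≤u
  ... | inj₁ a<u = greatestBetween-maximal (closed? e a) a (e a) u a<u u<ea closed
  ... | inj₂ refl = pop-≥

  pop-< : a < e a → pop e a < e a
  pop-< a<ea with pop-range
  ... | inj₁ pop≡a = subst (_< e a) (sym pop≡a) a<ea
  ... | inj₂ pop<ea = pop<ea

  pop-≤ : a ≤ e a → pop e a ≤ e a
  pop-≤ a≤ea with pop-range
  ... | inj₁ eq = ≤-trans (≤-reflexive eq) a≤ea
  ... | inj₂ lt = <⇒≤ lt

  pop-unique : ∀ v → a ≤ v → Closed e a v → v ≡ a ⊎ v < e a →
    (∀ u → a ≤ u → u < e a → Closed e a u → u ≤ v) → pop e a ≡ v
  pop-unique v a≤v closed range maximal = ≤-antisym pop≤v (v≤pop range)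
    where
    pop≤v : pop e a ≤ v
    pop≤v with pop-range
    ... | inj₁ eq = ≤-trans (≤-reflexive eq) a≤v
    ... | inj₂ lt = maximal (pop e a) pop-≥ lt pop-closed
    v≤pop : v ≡ a ⊎ v < e a → v ≤ pop e a
    v≤pop (inj₁ refl) = pop-≥
    v≤pop (inj₂ lt) = pop-maximal v a≤v lt closed

closed-cong : ∀ {e e′ a v} → (∀ m → a < m → m ≤ v → e m ≡ e′ m) →
  Closed e a v → Closed e′ a v
closed-cong agree closed m a<m m≤v = subst (_≤ _) (agree m a<m m≤v) (closed m a<m m≤v)

pop-local : ∀ e e′ a → a ≤ e a → e′ a ≡ e a → (∀ m → a < m → m ≤ e a → e′ m ≡ e m) →
  pop e′ a ≡ pop e a
pop-local e e′ a a≤ea same-a same-above = pop-unique e′ a (pop e a) (pop-≥ e a) closed range maximal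
  where
  closed : Closed e′ a (pop e a)
  closed = closed-cong (λ m a<m m≤pop → sym (same-above m a<m (≤-trans m≤pop (pop-≤ e a a≤ea))))
    (pop-closed e a)
  range : pop e a ≡ a ⊎ pop e a < e′ a
  range = map₂ (subst (pop e a <_) (sym same-a)) (pop-range e a)
  maximal : ∀ u → a ≤ u → u < e′ a → Closed e′ a u → u ≤ pop e a
  maximal u a≤u u<e′a closed′ = pop-maximal e a u a≤u u<ea
    (closed-cong (λ m a<m m≤u → same-above m a<m (≤-trans m≤u (<⇒≤ u<ea))) closed′)
    where
    u<ea : u < e a
    u<ea = subst (u <_) same-a u<e′a

-- Permutations and their inversions

injective⇒surjective : ∀ {n} (f : Fin n → Fin n) → (∀ i j → f i ≡ f j → i ≡ j) →
  ∀ k → Σ (Fin n) λ i → f i ≡ k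
injective⇒surjective f inj k with any? (λ i → f i FP.≟ k)
... | yes hit = hit
injective⇒surjective {suc n} f inj k | no miss
  with pigeonhole (n<1+n n) (λ i → punchOut {i = k} {j = f i} (λ eq → miss (i , sym eq)))
... | i , j , i<j , eq =
  ⊥-elim (<⇒≢ i<j (cong toℕ (inj i j
    (punchOut-injective (λ eq → miss (i , sym eq)) (λ eq → miss (j , sym eq)) eq))))

vec-ext : ∀ {A : Set} {n} (u v : Vec A n) → (∀ i → lookup u i ≡ lookup v i) → u ≡ v
vec-ext u v h = trans (sym (tabulate∘lookup u)) (trans (tabulate-cong h) (tabulate∘lookup v))

module Positions {n : ℕ} {w : Word n} (perm : IsPerm w) where

  position : Fin n → Fin n
  position a = proj₁ (injective⇒surjective (lookup w) perm a)

  lookup-position : ∀ a → lookup w (position a) ≡ a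
  lookup-position a = proj₂ (injective⇒surjective (lookup w) perm a)

  position-lookup : ∀ i → position (lookup w i) ≡ i
  position-lookup i = perm _ i (lookup-position (lookup w i))

  position-injective : ∀ a b → position a ≡ position b → a ≡ b
  position-injective a b eq = trans (sym (lookup-position a)) (trans (cong (lookup w) eq) (lookup-position b))

  inv⇒position-> : ∀ a b → Inv w a b → position b F.< position a
  inv⇒position-> _ _ (_ , i , j , i<j , refl , refl) =
    subst₂ F._<_ (sym (position-lookup i)) (sym (position-lookup j)) i<j

  position->⇒inv : ∀ a b → a F.< b → position b F.< position a → Inv w a b
  position->⇒inv a b a<b pb<pa = a<b , position b , position a , pb<pa , lookup-position b , lookup-position a

  inv? : ∀ a b → Dec (Inv w a b)
  inv? a b = map′ (λ (a<b , pb<pa) → position->⇒inv a b a<b pb<pa)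
                  (λ inv → proj₁ inv , inv⇒position-> a b inv)
                  ((a F.<? b) ×-dec (position b F.<? position a))

AgreeBelow : ∀ {n} → Word n → Word n → Fin n → Set
AgreeBelow u v i = ∀ {j} → j F.< i → lookup u j ≡ lookup v j

module FirstDifference {n : ℕ} {u v : Word n} (permU : IsPerm u) (permV : IsPerm v) {i : Fin n}
                       (agree : AgreeBelow u v i) (lt : lookup u i F.< lookup v i) where
  open Positions {w = v} permV

  inv-right : Inv v (lookup u i) (lookup v i)
  inv-right = lt , i , position (lookup u i) , i<pos , refl , lookup-position _
    where
    i<pos : i F.< position (lookup u i)
    i<pos with FP.<-cmp i (position (lookup u i))
    ... | tri< i<p _ _ = i<p
    ... | tri≈ _ i≡p _ =
      ⊥-elim (<⇒≢ lt (cong toℕ (sym (trans (cong (lookup v) i≡p) (lookup-position _)))))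
    ... | tri> _ _ p<i = ⊥-elim (<⇒≢ p<i (cong toℕ (permU _ i (trans (agree p<i) (lookup-position _)))))

  ¬inv-left : ¬ Inv u (lookup u i) (lookup v i)
  ¬inv-left (_ , j , k , j<k , uj≡vi , uk≡ui) with permU k i uk≡ui
  ... | refl = <⇒≢ j<k (cong toℕ (permV j k (trans (sym (agree j<k)) uj≡vi)))

inversions-determine : ∀ {n} {u v : Word n} → IsPerm u → IsPerm v → u ≤W v → v ≤W u → u ≡ v
inversions-determine {u = u} {v} permU permV u≤v v≤u =
  vec-ext u v (All.wfRec <-wellFounded 0ℓ (λ i → lookup u i ≡ lookup v i) agreeAt)
  where
  agreeAt : ∀ i → AgreeBelow u v i → lookup u i ≡ lookup v i
  agreeAt i agree with FP.<-cmp (lookup u i) (lookup v i)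
  ... | tri≈ _ eq _ = eq
  ... | tri< lt _ _ = ⊥-elim (¬inv-left (v≤u _ _ inv-right))
    where open FirstDifference {u = u} {v} permU permV agree lt
  ... | tri> _ _ gt = ⊥-elim (¬inv-left (u≤v _ _ inv-right))
    where open FirstDifference {u = v} {u} permV permU (λ j<i → sym (agree j<i)) gt

-- Brackets of 312-avoiding permutations

record IsBracket (n : ℕ) (e : ℕ → ℕ) : Set where
  field
    ≤-bracket : ∀ a → a < n → a ≤ e a
    bracket-< : ∀ a → a < n → e a < n
    nested : ∀ a m → a < n → a < m → m ≤ e a → e m ≤ e a

record IsBracketOf {n : ℕ} (w : Word n) (e : ℕ → ℕ) : Set where
  field
    isBracket : IsBracket n e
    inv⇒≤ : ∀ a b → Inv w a b → toℕ b ≤ e (toℕ a)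
    ≤⇒inv : ∀ a b → a F.< b → toℕ b ≤ e (toℕ a) → Inv w a b
  open IsBracket isBracket public

_≤[_]_ : (ℕ → ℕ) → ℕ → (ℕ → ℕ) → Set
f ≤[ n ] g = ∀ a → a < n → f a ≤ g a

≤[]-congʳ : ∀ {f g h n} → (∀ a → a < n → g a ≡ h a) → f ≤[ n ] g ⇔ f ≤[ n ] h
≤[]-congʳ {f} g≡h = mk⇔ (λ f≤g a a<n → subst (f a ≤_) (g≡h a a<n) (f≤g a a<n))
                        (λ f≤h a a<n → subst (f a ≤_) (sym (g≡h a a<n)) (f≤h a a<n))

module _ {n : ℕ} {u v : Word n} {f g : ℕ → ℕ} (U : IsBracketOf u f) (V : IsBracketOf v g) where
  private
    module U = IsBracketOf U
    module V = IsBracketOf V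

  ≤⇒≤W : f ≤[ n ] g → u ≤W v
  ≤⇒≤W f≤g a b inv =
    V.≤⇒inv a b (proj₁ inv) (≤-trans (U.inv⇒≤ a b inv) (f≤g (toℕ a) (toℕ<n a)))

  ≤W⇒≤ : u ≤W v → f ≤[ n ] g
  ≤W⇒≤ u≤v a a<n with a <? f a
  ... | no a≮fa = ≤-trans (≮⇒≥ a≮fa) (V.≤-bracket a a<n)
  ... | yes a<fa = subst₂ _≤_ toℕ-end (cong g toℕ-start) (V.inv⇒≤ start end (u≤v start end inv))
    where
    start = fromℕ< a<n
    end = fromℕ< (U.bracket-< a a<n)
    toℕ-start : toℕ start ≡ a
    toℕ-start = toℕ-fromℕ< a<n
    toℕ-end : toℕ end ≡ f a
    toℕ-end = toℕ-fromℕ< (U.bracket-< a a<n)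
    inv : Inv u start end
    inv = U.≤⇒inv start end (subst₂ _<_ (sym toℕ-start) (sym toℕ-end) a<fa)
            (subst₂ _≤_ (sym toℕ-end) (cong f (sym toℕ-start)) ≤-refl)

bracket-unique : ∀ {n} {u : Word n} {f g} → IsBracketOf u f → IsBracketOf u g →
  ∀ a → a < n → f a ≡ g a
bracket-unique F G a a<n =
  ≤-antisym (≤W⇒≤ F G (λ _ _ inv → inv) a a<n) (≤W⇒≤ G F (λ _ _ inv → inv) a a<n)

module _ {n : ℕ} {u v : Word n} {f g : ℕ → ℕ} where

  bracket-injective : IsPerm u → IsPerm v → IsBracketOf u f → IsBracketOf v g →
    (∀ a → a < n → f a ≡ g a) → u ≡ v
  bracket-injective permU permV U V f≡g = inversions-determine permU permV
    (≤⇒≤W U V (λ a a<n → ≤-reflexive (f≡g a a<n)))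
    (≤⇒≤W V U (λ a a<n → ≤-reflexive (sym (f≡g a a<n))))

module TamBracket {n : ℕ} (w : Word n) (tam : Tam w) where
  open Positions {w = w} (proj₁ tam)

  inv-interval : ∀ a m c → a F.< m → m F.< c → Inv w a c → Inv w a m
  inv-interval a m c a<m m<c inv-ac with position m F.<? position a
  ... | yes pm<pa = position->⇒inv a m a<m pm<pa
  ... | no pm≮pa = ⊥-elim (proj₂ tam (position c , position a , position m ,
          inv⇒position-> a c inv-ac , pa<pm ,
          subst₂ F._<_ (sym (lookup-position a)) (sym (lookup-position m)) a<m ,
          subst₂ F._<_ (sym (lookup-position m)) (sym (lookup-position c)) m<c))
    where
    pa<pm : position a F.< position m
    pa<pm = ≤∧≢⇒< (≮⇒≥ pm≮pa)
      (λ eq → <⇒≢ a<m (cong toℕ (position-injective a m (toℕ-injective eq))))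

  inv-trans : ∀ a m c → Inv w a m → Inv w m c → Inv w a c
  inv-trans a m c inv-am inv-mc = position->⇒inv a c (<-trans (proj₁ inv-am) (proj₁ inv-mc))
    (<-trans (inv⇒position-> m c inv-mc) (inv⇒position-> a m inv-am))

  InvAt : ℕ → ℕ → Set
  InvAt a b = Σ (a < n) λ a<n → Σ (b < n) λ b<n → Inv w (fromℕ< a<n) (fromℕ< b<n)

  invAt? : ∀ a → Decidable (InvAt a)
  invAt? a b with a <? n | b <? n
  ... | no a≮n | _ = no (λ inv → a≮n (proj₁ inv))
  ... | yes _ | no b≮n = no (λ inv → b≮n (proj₁ (proj₂ inv)))
  ... | yes a<n | yes b<n =
    map′ (λ inv → a<n , b<n , inv) (λ inv → proj₂ (proj₂ inv)) (inv? (fromℕ< a<n) (fromℕ< b<n))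

  invAt-< : ∀ a b → InvAt a b → a < b
  invAt-< a b (a<n , b<n , inv) = subst₂ _<_ (toℕ-fromℕ< a<n) (toℕ-fromℕ< b<n) (proj₁ inv)

  invAt-interval : ∀ a m c → a < m → m < c → InvAt a c → InvAt a m
  invAt-interval a m c a<m m<c (a<n , c<n , inv) = a<n , m<n , inv-interval _ _ _
      (subst₂ _<_ (sym (toℕ-fromℕ< a<n)) (sym (toℕ-fromℕ< m<n)) a<m)
      (subst₂ _<_ (sym (toℕ-fromℕ< m<n)) (sym (toℕ-fromℕ< c<n)) m<c) inv
    where
    m<n : m < n
    m<n = <-trans m<c c<n

  invAt-trans : ∀ a m c → InvAt a m → InvAt m c → InvAt a c
  invAt-trans a m c (a<n , _ , inv₁) (_ , c<n , inv₂) = a<n , c<n , inv-trans _ _ _ inv₁ inv₂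

  inv⇒invAt : ∀ x y → Inv w x y → InvAt (toℕ x) (toℕ y)
  inv⇒invAt x y inv = toℕ<n x , toℕ<n y ,
    subst₂ (Inv w) (sym (fromℕ<-toℕ x (toℕ<n x))) (sym (fromℕ<-toℕ y (toℕ<n y))) inv

  invAt⇒inv : ∀ x y → InvAt (toℕ x) (toℕ y) → Inv w x y
  invAt⇒inv x y (x<n , y<n , inv) = subst₂ (Inv w) (fromℕ<-toℕ x x<n) (fromℕ<-toℕ y y<n) inv

  bracket : ℕ → ℕ
  bracket a = greatestBetween (invAt? a) a n

  invAt⇒≤ : ∀ a b → InvAt a b → b ≤ bracket a
  invAt⇒≤ a b inv = greatestBetween-maximal (invAt? a) a n b (invAt-< a b inv) (proj₁ (proj₂ inv)) inv

  ≤⇒invAt : ∀ a b → a < b → b ≤ bracket a → InvAt a b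
  ≤⇒invAt a b a<b b≤e with greatestBetween-found (invAt? a) a n
  ... | inj₁ e≡a = contradiction (≤-trans b≤e (≤-reflexive e≡a)) (<⇒≱ a<b)
  ... | inj₂ (_ , inv) with m≤n⇒m<n∨m≡n b≤e
  ...   | inj₁ b<e = invAt-interval a b (bracket a) a<b b<e inv
  ...   | inj₂ refl = inv

  isBracket : IsBracket n bracket
  isBracket = record
    { ≤-bracket = λ a _ → greatestBetween-≥ (invAt? a) a n
    ; bracket-< = bracket-<
    ; nested = nested
    }
    where
    bracket-< : ∀ a → a < n → bracket a < n
    bracket-< a a<n with greatestBetween-found (invAt? a) a n
    ... | inj₁ e≡a = subst (_< n) (sym e≡a) a<n
    ... | inj₂ (e<n , _) = e<n
    nested : ∀ a m → a < n → a < m → m ≤ bracket a → bracket m ≤ bracket a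
    nested a m a<n a<m m≤e with greatestBetween-found (invAt? m) m n
    ... | inj₁ e≡m = ≤-trans (≤-reflexive e≡m) m≤e
    ... | inj₂ (_ , inv) = invAt⇒≤ a _ (invAt-trans a m _ (≤⇒invAt a m a<m m≤e) inv)

  isBracketOf : IsBracketOf w bracket
  isBracketOf = record
    { isBracket = isBracket
    ; inv⇒≤ = λ x y inv → invAt⇒≤ _ _ (inv⇒invAt x y inv)
    ; ≤⇒inv = λ x y x<y y≤e → invAt⇒inv x y (≤⇒invAt _ _ x<y y≤e)
    }

∸-nested-< : ∀ a b eb ea → a < b → b ≤ eb → eb ≤ ea → (eb ∸ b) + (b ∸ suc a) < ea ∸ a
∸-nested-< a b eb ea a<b b≤eb eb≤ea = begin-strict
  (eb ∸ b) + (b ∸ suc a)  ≡⟨ +-∸-assoc (eb ∸ b) a<b ⟨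
  (eb ∸ b) + b ∸ suc a    ≡⟨ cong (_∸ suc a) (m∸n+n≡m b≤eb) ⟩
  eb ∸ suc a              ≤⟨ ∸-monoˡ-≤ (suc a) eb≤ea ⟩
  ea ∸ suc a              <⟨ ∸-monoʳ-< (n<1+n a) (<-≤-trans a<b (≤-trans b≤eb eb≤ea)) ⟩
  ea ∸ a                  ∎
  where open ≤-Reasoning

module FromBracket {n : ℕ} {e : ℕ → ℕ} (B : IsBracket n e) where
  open IsBracket B

  earlierSmaller : ℕ → ℕ
  earlierSmaller a = count (λ c → e c <? a) a

  smallerEndingBefore? : ∀ a → Decidable (λ c → c < a × e c < a)
  smallerEndingBefore? a c = (c <? a) ×-dec (e c <? a)

  inBracket? : ∀ a → Decidable (λ c → c < suc (e a) × a ≤ c)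
  inBracket? a c = (c <? suc (e a)) ×-dec (a ≤? c)

  -- The letter a is preceded exactly by the e a ∸ a letters of (a, e a], which are
  -- inverted with it, and by the smaller letters c whose bracket ends before a.
  placeℕ : ℕ → ℕ
  placeℕ a = (e a ∸ a) + earlierSmaller a

  placeℕ-< : ∀ a → a < n → placeℕ a < n
  placeℕ-< a a<n = begin-strict
    (e a ∸ a) + earlierSmaller a  ≤⟨ +-monoʳ-≤ (e a ∸ a) (count-≤ _ a) ⟩
    (e a ∸ a) + a                 ≡⟨ m∸n+n≡m (≤-bracket a a<n) ⟩
    e a                           <⟨ bracket-< a a<n ⟩
    n                             ∎
    where open ≤-Reasoning

  count-smallerEndingBefore : ∀ a b → a ≤ b → count (smallerEndingBefore? a) b ≡ earlierSmaller a
  count-smallerEndingBefore a b a≤b =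
    count-restrict _ (λ c → e c <? a) a b a≤b (λ _ p → p) (λ _ c<a ec<a → c<a , ec<a)

  count-inBracket : ∀ a b → e a < b → count (inBracket? a) b ≡ suc (e a) ∸ a
  count-inBracket a b ea<b = trans
    (count-restrict _ (a ≤?_) (suc (e a)) b ea<b (λ _ p → p) (λ _ c<s a≤c → c<s , a≤c))
    (count-atLeast (a ≤?_) a (suc (e a)) (λ _ p → p) (λ _ p → p))

  placeℕ-inside : ∀ a b → a < b → b < n → b ≤ e a → placeℕ b < placeℕ a
  placeℕ-inside a b a<b b<n b≤ea = begin-strict
    (e b ∸ b) + earlierSmaller b                  ≤⟨ +-monoʳ-≤ (e b ∸ b) earlierSmaller-b ⟩
    (e b ∸ b) + (earlierSmaller a + (b ∸ suc a))  ≡⟨ x∙yz≈y∙xz (e b ∸ b) (earlierSmaller a) _ ⟩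
    earlierSmaller a + ((e b ∸ b) + (b ∸ suc a))  <⟨ +-monoʳ-< (earlierSmaller a) lengths ⟩
    earlierSmaller a + (e a ∸ a)                  ≡⟨ +-comm (earlierSmaller a) (e a ∸ a) ⟩
    (e a ∸ a) + earlierSmaller a                  ∎
    where
    open ≤-Reasoning
    a<n = <-trans a<b b<n
    eb≤ea = nested a b a<n a<b b≤ea
    lengths = ∸-nested-< a b (e b) (e a) a<b (≤-bracket b b<n) eb≤ea
    split : ∀ c → c < b → e c < b → (c < a × e c < a) ⊎ suc a ≤ c
    split c c<b ec<b with c <? a
    ... | yes c<a with e c <? a
    ...   | yes ec<a = inj₁ (c<a , ec<a)
    ...   | no ec≮a =
      contradiction (≤-trans b≤ea (nested c a (<-trans c<a a<n) c<a (≮⇒≥ ec≮a))) (<⇒≱ ec<b)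
    split c c<b ec<b | no c≮a with m≤n⇒m<n∨m≡n (≮⇒≥ c≮a)
    ... | inj₁ a<c = inj₂ a<c
    ... | inj₂ refl = contradiction b≤ea (<⇒≱ ec<b)
    earlierSmaller-b : earlierSmaller b ≤ earlierSmaller a + (b ∸ suc a)
    earlierSmaller-b = ≤-trans (count-⊆-∪ (smallerEndingBefore? a) (suc a ≤?_) (λ c → e c <? b) b split)
      (≤-reflexive (cong₂ _+_ (count-smallerEndingBefore a b (<⇒≤ a<b))
                              (count-atLeast (suc a ≤?_) (suc a) b (λ _ p → p) (λ _ p → p))))

  placeℕ-outside : ∀ a b → a < b → b < n → e a < b → placeℕ a < placeℕ b
  placeℕ-outside a b a<b b<n ea<b = begin-strict
    (e a ∸ a) + earlierSmaller a        ≡⟨ +-comm (e a ∸ a) (earlierSmaller a) ⟩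
    earlierSmaller a + (e a ∸ a)        <⟨ +-monoʳ-< (earlierSmaller a) (n<1+n (e a ∸ a)) ⟩
    earlierSmaller a + suc (e a ∸ a)    ≡⟨ cong (earlierSmaller a +_) (+-∸-assoc 1 (≤-bracket a a<n)) ⟨
    earlierSmaller a + (suc (e a) ∸ a)  ≤⟨ earlierSmaller-b ⟩
    earlierSmaller b                    ≤⟨ m≤n+m (earlierSmaller b) (e b ∸ b) ⟩
    (e b ∸ b) + earlierSmaller b        ∎
    where
    open ≤-Reasoning
    a<n = <-trans a<b b<n
    endsBefore-b : ∀ c → c < b → (c < a × e c < a) ⊎ (c < suc (e a) × a ≤ c) → e c < b
    endsBefore-b c _ (inj₁ (_ , ec<a)) = <-trans ec<a a<b
    endsBefore-b c _ (inj₂ (c≤ea , a≤c)) with m≤n⇒m<n∨m≡n a≤c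
    ... | inj₁ a<c = ≤-<-trans (nested a c a<n a<c (s≤s⁻¹ c≤ea)) ea<b
    ... | inj₂ refl = ea<b
    earlierSmaller-b : earlierSmaller a + (suc (e a) ∸ a) ≤ earlierSmaller b
    earlierSmaller-b = subst₂ (λ x y → x + y ≤ earlierSmaller b)
      (count-smallerEndingBefore a b (<⇒≤ a<b)) (count-inBracket a b ea<b)
      (count-disjoint-∪ (smallerEndingBefore? a) (inBracket? a) (λ c → e c <? b) b
        (λ _ _ (c<a , _) (_ , a≤c) → <⇒≱ c<a a≤c) endsBefore-b)

  place : Fin n → Fin n
  place a = fromℕ< (placeℕ-< (toℕ a) (toℕ<n a))

  toℕ-place : ∀ a → toℕ (place a) ≡ placeℕ (toℕ a)
  toℕ-place a = toℕ-fromℕ< _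

  place-inside : ∀ a b → a F.< b → toℕ b ≤ e (toℕ a) → place b F.< place a
  place-inside a b a<b b≤ea = subst₂ _<_ (sym (toℕ-place b)) (sym (toℕ-place a))
    (placeℕ-inside (toℕ a) (toℕ b) a<b (toℕ<n b) b≤ea)

  place-outside : ∀ a b → a F.< b → e (toℕ a) < toℕ b → place a F.< place b
  place-outside a b a<b ea<b = subst₂ _<_ (sym (toℕ-place a)) (sym (toℕ-place b))
    (placeℕ-outside (toℕ a) (toℕ b) a<b (toℕ<n b) ea<b)

  place-≢ : ∀ a b → a F.< b → place a ≢ place b
  place-≢ a b a<b eq with toℕ b ≤? e (toℕ a)
  ... | yes b≤ea = <⇒≢ (place-inside a b a<b b≤ea) (cong toℕ (sym eq))
  ... | no b≰ea = <⇒≢ (place-outside a b a<b (≰⇒> b≰ea)) (cong toℕ eq)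

  place-injective : ∀ a b → place a ≡ place b → a ≡ b
  place-injective a b eq with FP.<-cmp a b
  ... | tri< a<b _ _ = ⊥-elim (place-≢ a b a<b eq)
  ... | tri≈ _ a≡b _ = a≡b
  ... | tri> _ _ b<a = ⊥-elim (place-≢ b a b<a (sym eq))

  letterAt : Fin n → Fin n
  letterAt i = proj₁ (injective⇒surjective place place-injective i)

  place-letterAt : ∀ i → place (letterAt i) ≡ i
  place-letterAt i = proj₂ (injective⇒surjective place place-injective i)

  word : Word n
  word = tabulate letterAt

  place-lookup : ∀ i → place (lookup word i) ≡ i
  place-lookup i = trans (cong place (lookup∘tabulate letterAt i)) (place-letterAt i)

  lookup-place : ∀ a → lookup word (place a) ≡ a
  lookup-place a = place-injective _ a (place-lookup (place a))

  inv⇒≤ : ∀ a b → Inv word a b → toℕ b ≤ e (toℕ a)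
  inv⇒≤ a b (a<b , i , j , i<j , refl , refl) with toℕ (lookup word i) ≤? e (toℕ (lookup word j))
  ... | yes b≤ea = b≤ea
  ... | no b≰ea = contradiction
    (subst₂ F._<_ (place-lookup j) (place-lookup i) (place-outside _ _ a<b (≰⇒> b≰ea))) (<⇒≯ i<j)

  isBracketOf : IsBracketOf word e
  isBracketOf = record
    { isBracket = B
    ; inv⇒≤ = inv⇒≤
    ; ≤⇒inv = λ a b a<b b≤ea →
        a<b , place b , place a , place-inside a b a<b b≤ea , lookup-place b , lookup-place a
    }

  tam : Tam word
  tam = perm , avoids
    where
    perm : IsPerm word
    perm i j eq = trans (sym (place-lookup i)) (trans (cong place eq) (place-lookup j))
    avoids : Avoids312 word
    avoids (i , j , k , i<j , j<k , wj<wk , wk<wi) = <⇒≯ j<k (subst₂ F._<_ (place-lookup k) (place-lookup j)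
      (place-inside _ _ wj<wk (≤-trans (<⇒≤ wk<wi) (inv⇒≤ _ _ inv-ji))))
      where
      inv-ji : Inv word (lookup word j) (lookup word i)
      inv-ji = <-trans wj<wk wk<wi , i , j , i<j , refl , refl

-- Covers in the Tamari lattice

update : (ℕ → ℕ) → ℕ → ℕ → ℕ → ℕ
update e a v b with b ≟ a
... | yes _ = v
... | no _ = e b

update-≡ : ∀ e a v → update e a v a ≡ v
update-≡ e a v with a ≟ a
... | yes _ = refl
... | no a≢a = contradiction refl a≢a

update-≢ : ∀ e a v b → b ≢ a → update e a v b ≡ e b
update-≢ e a v b b≢a with b ≟ a
... | yes b≡a = contradiction b≡a b≢a
... | no _ = refl

lowerAt : (ℕ → ℕ) → ℕ → ℕ → ℕ
lowerAt e a = update e a (pop e a)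

module _ {n : ℕ} {e : ℕ → ℕ} (E : IsBracket n e) (a : ℕ) where
  open IsBracket E

  lowerAt-≤ : lowerAt e a ≤[ n ] e
  lowerAt-≤ b b<n with b ≟ a
  ... | yes refl = pop-≤ e b (≤-bracket b b<n)
  ... | no _ = ≤-refl

  pop≤lowerAt : pop e ≤[ n ] lowerAt e a
  pop≤lowerAt b b<n with b ≟ a
  ... | yes refl = ≤-refl
  ... | no _ = pop-≤ e b (≤-bracket b b<n)

  lowerAt-isBracket : IsBracket n (lowerAt e a)
  lowerAt-isBracket = record
    { ≤-bracket = self-≤
    ; bracket-< = λ b b<n → ≤-<-trans (lowerAt-≤ b b<n) (bracket-< b b<n)
    ; nested = nested′
    }
    where
    self-≤ : ∀ b → b < n → b ≤ lowerAt e a b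
    self-≤ b b<n with b ≟ a
    ... | yes refl = pop-≥ e b
    ... | no _ = ≤-bracket b b<n
    nested′ : ∀ b m → b < n → b < m → m ≤ lowerAt e a b → lowerAt e a m ≤ lowerAt e a b
    nested′ b m b<n b<m m≤ with b ≟ a
    ... | yes refl = subst (_≤ pop e b) (sym (update-≢ e b (pop e b) m (λ m≡b → <⇒≢ b<m (sym m≡b))))
                       (pop-closed e b m b<m m≤)
    ... | no _ = ≤-trans (lowerAt-≤ m (≤-<-trans m≤ (bracket-< b b<n))) (nested b m b<n b<m m≤)

  ≤-lowerAt : ∀ {f} → f ≤[ n ] e → a ≤ f a → f a < e a → Closed e a (f a) → f ≤[ n ] lowerAt e a
  ≤-lowerAt f≤e a≤fa fa<ea closed b b<n with b ≟ a
  ... | yes refl = pop-maximal e b _ a≤fa fa<ea closed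
  ... | no _ = f≤e b b<n

closed-agreeingAbove : ∀ {n e f a} → IsBracket n f → a < n → (∀ m → a < m → m ≤ f a → f m ≡ e m) →
  Closed e a (f a)
closed-agreeingAbove F a<n agree m a<m m≤fa =
  subst (_≤ _) (agree m a<m m≤fa) (IsBracket.nested F _ m a<n a<m m≤fa)

LowerBound : ∀ {n} → (Word n → Set) → Word n → Set
LowerBound S w = ∀ s → S s → w ≤W s

module Covers {n : ℕ} {y : Word n} (tamY : Tam y) {e : ℕ → ℕ} (Y : IsBracketOf y e) where
  open IsBracketOf Y

  module Lowered (a : ℕ) = FromBracket (lowerAt-isBracket isBracket a)

  lowered : ℕ → Word n
  lowered = Lowered.word

  lowered-bracket : ∀ {a w} → lowered a ≡ w → IsBracketOf w (lowerAt e a)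
  lowered-bracket {a} refl = Lowered.isBracketOf a

  lowered-≤W : ∀ a → lowered a ≤W y
  lowered-≤W a = ≤⇒≤W (Lowered.isBracketOf a) Y (lowerAt-≤ isBracket a)

  lowered-≢ : ∀ a → a < n → a < e a → lowered a ≢ y
  lowered-≢ a a<n a<ea lowered≡y = <⇒≢ (pop-< e a a<ea)
    (trans (sym (update-≡ e a (pop e a))) (bracket-unique (lowered-bracket lowered≡y) Y a a<n))

  lowered-⋖ : ∀ a → a < n → a < e a → lowered a ⋖T y
  lowered-⋖ a a<n a<ea = Lowered.tam a , tamY , lowered-≤W a , lowered-≢ a a<n a<ea , between
    where
    between : ∀ z → Tam z → lowered a ≤W z → z ≤W y → z ≡ lowered a ⊎ z ≡ y
    between z tamZ lowered≤z z≤y = decide (g a <? e a)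
      where
      Z = TamBracket.isBracketOf z tamZ
      g = TamBracket.bracket z tamZ
      open IsBracketOf Z using () renaming (≤-bracket to ≤-g; bracket-< to g-<)
      lower : lowerAt e a ≤[ n ] g
      lower = ≤W⇒≤ (Lowered.isBracketOf a) Z lowered≤z
      upper : g ≤[ n ] e
      upper = ≤W⇒≤ Z Y z≤y
      agree : ∀ b → b < n → b ≢ a → g b ≡ e b
      agree b b<n b≢a = ≤-antisym (upper b b<n) (subst (_≤ g b) (update-≢ e a (pop e a) b b≢a) (lower b b<n))
      decide : Dec (g a < e a) → z ≡ lowered a ⊎ z ≡ y
      decide (yes ga<ea) = inj₁ (bracket-injective (proj₁ tamZ) (proj₁ (Lowered.tam a)) Z (Lowered.isBracketOf a)
        (λ b b<n → ≤-antisym (g≤lowerAt b b<n) (lower b b<n)))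
        where
        closed : Closed e a (g a)
        closed = closed-agreeingAbove (IsBracketOf.isBracket Z) a<n
          (λ m a<m m≤ga → agree m (≤-<-trans m≤ga (g-< a a<n)) (λ m≡a → <⇒≢ a<m (sym m≡a)))
        g≤lowerAt : g ≤[ n ] lowerAt e a
        g≤lowerAt = ≤-lowerAt isBracket a upper (≤-g a a<n) ga<ea closed
      decide (no ga≮ea) = inj₂ (bracket-injective (proj₁ tamZ) (proj₁ tamY) Z Y g≡e)
        where
        g≡e : ∀ b → b < n → g b ≡ e b
        g≡e b b<n with b ≟ a
        ... | yes refl = ≤-antisym (upper b b<n) (≮⇒≥ ga≮ea)
        ... | no b≢a = agree b b<n b≢a

  ⋖⇒pop≤ : ∀ {s f} → s ⋖T y → IsBracketOf s f → pop e ≤[ n ] f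
  ⋖⇒pop≤ {s} {f} (tamS , _ , s≤y , s≢y , between) S
    with lastCounterexample (λ a → f a ≟ e a) n
           (λ f≡e → s≢y (bracket-injective (proj₁ tamS) (proj₁ tamY) S Y f≡e))
  ... | a , a<n , fa≢ea , agreeAbove = collapse (between (lowered a) (Lowered.tam a) s≤lowered (lowered-≤W a))
    where
    open IsBracketOf S using () renaming (≤-bracket to ≤-f; bracket-< to f-<)
    f≤e : f ≤[ n ] e
    f≤e = ≤W⇒≤ S Y s≤y
    fa<ea : f a < e a
    fa<ea = ≤∧≢⇒< (f≤e a a<n) fa≢ea
    closed : Closed e a (f a)
    closed = closed-agreeingAbove (IsBracketOf.isBracket S) a<n
      (λ m a<m m≤fa → agreeAbove m a<m (≤-<-trans m≤fa (f-< a a<n)))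
    s≤lowered : s ≤W lowered a
    s≤lowered = ≤⇒≤W S (Lowered.isBracketOf a) (≤-lowerAt isBracket a f≤e (≤-f a a<n) fa<ea closed)
    collapse : lowered a ≡ s ⊎ lowered a ≡ y → pop e ≤[ n ] f
    collapse (inj₁ lowered≡s) b b<n = ≤-trans (pop≤lowerAt isBracket a b b<n)
      (≤-reflexive (bracket-unique (lowered-bracket lowered≡s) S b b<n))
    collapse (inj₂ lowered≡y) = ⊥-elim (lowered-≢ a a<n (≤-<-trans (≤-f a a<n) fa<ea) lowered≡y)

  lowerBound⇔≤pop : ∀ {w f} → IsBracketOf w f → LowerBound (PopSet y) w ⇔ f ≤[ n ] pop e
  lowerBound⇔≤pop {w} {f} W = mk⇔ lowerBound⇒≤pop ≤pop⇒lowerBound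
    where
    lowerBound⇒≤pop : LowerBound (PopSet y) w → f ≤[ n ] pop e
    lowerBound⇒≤pop lb a a<n with a <? e a
    ... | yes a<ea = subst (f a ≤_) (update-≡ e a (pop e a))
      (≤W⇒≤ W (Lowered.isBracketOf a) (lb _ (inj₂ (lowered-⋖ a a<n a<ea))) a a<n)
    ... | no a≮ea = ≤-trans (≤W⇒≤ W Y (lb y (inj₁ refl)) a a<n) (≤-trans (≮⇒≥ a≮ea) (pop-≥ e a))
    ≤pop⇒lowerBound : f ≤[ n ] pop e → LowerBound (PopSet y) w
    ≤pop⇒lowerBound f≤pop _ (inj₁ refl) =
      ≤⇒≤W W Y (λ a a<n → ≤-trans (f≤pop a a<n) (pop-≤ e a (≤-bracket a a<n)))
    ≤pop⇒lowerBound f≤pop s (inj₂ s⋖y) =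
      ≤⇒≤W W S (λ a a<n → ≤-trans (f≤pop a a<n) (⋖⇒pop≤ s⋖y S a a<n))
      where
      S = TamBracket.isBracketOf s (proj₁ s⋖y)

-- Raising a bracket without changing its pop

PopClosedBelow : (ℕ → ℕ) → ℕ → Set
PopClosedBelow e a = ∀ c → c < a → pop e c < a

module Raise (m : ℕ) {e : ℕ → ℕ} (E : IsBracket (suc m) e) where
  open IsBracket E

  popClosed? : Decidable (PopClosedBelow e)
  popClosed? a = map′ (λ closed c → closed {c}) (λ closed {c} → closed c) (allUpTo? (λ c → pop e c <? a) a)

  raised : ℕ → ℕ
  raised a with popClosed? a
  ... | yes _ = m
  ... | no _ = e a

  raised-closed : ∀ a → PopClosedBelow e a → raised a ≡ m
  raised-closed a closed with popClosed? a
  ... | yes _ = refl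
  ... | no open′ = contradiction closed open′

  raised-open : ∀ a → ¬ PopClosedBelow e a → raised a ≡ e a
  raised-open a open′ with popClosed? a
  ... | yes closed = contradiction closed open′
  ... | no _ = refl

  open-inside : ∀ a b → a < suc m → ¬ PopClosedBelow e a → a < b → b ≤ e a → ¬ PopClosedBelow e b
  -- Some block [c, pop e c] with c < a reaches a, so it also contains the bracket (a, e a].
  open-inside a b a<n open′ a<b b≤ea closed
    with lastCounterexample (λ c → pop e c <? a) a open′
  ... | c , c<a , a≤pop , _ = <⇒≱ (closed c (<-trans c<a a<b))
    (≤-trans b≤ea (pop-closed e c a c<a (≮⇒≥ a≤pop)))

  raised-isBracket : IsBracket (suc m) raised
  raised-isBracket = record { ≤-bracket = self-≤ ; bracket-< = raised-< ; nested = nested′ }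
    where
    self-≤ : ∀ a → a < suc m → a ≤ raised a
    self-≤ a a<n with popClosed? a
    ... | yes _ = s≤s⁻¹ a<n
    ... | no _ = ≤-bracket a a<n
    raised-< : ∀ a → a < suc m → raised a < suc m
    raised-< a a<n with popClosed? a
    ... | yes _ = ≤-refl
    ... | no _ = bracket-< a a<n
    nested′ : ∀ a b → a < suc m → a < b → b ≤ raised a → raised b ≤ raised a
    nested′ a b a<n a<b b≤ with popClosed? a | popClosed? b
    ... | yes _ | yes _ = ≤-refl
    ... | yes _ | no _ = s≤s⁻¹ (bracket-< b (s≤s b≤))
    ... | no open′ | yes closed = contradiction closed (open-inside a b a<n open′ a<b b≤)
    ... | no _ | no _ = nested a b a<n a<b b≤

  pop-raised-open : ∀ a → a < suc m → ¬ PopClosedBelow e a → pop raised a ≡ pop e a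
  pop-raised-open a a<n open′ = pop-local e raised a (≤-bracket a a<n) (raised-open a open′)
    (λ b a<b b≤ea → raised-open b (open-inside a b a<n open′ a<b b≤ea))

  pop-raised-closed : ∀ a → a < suc m → PopClosedBelow e a → pop raised a ≡ pop e a
  pop-raised-closed a a<n closed = pop-unique raised a (pop e a) (pop-≥ e a) closed-pop range maximal
    where
    P = pop e a
    closed-pop : Closed raised a P
    closed-pop = closed-cong (λ b a<b b≤P → sym (raised-open b (λ closedB → <⇒≱ (closedB a a<b) b≤P)))
      (pop-closed e a)
    range : P ≡ a ⊎ P < raised a
    range = map₂ (λ P<ea → <-≤-trans P<ea (subst (e a ≤_) (sym (raised-closed a closed)) (s≤s⁻¹ (bracket-< a a<n))))
                 (pop-range e a)
    closed-after-pop : PopClosedBelow e (suc P)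
    closed-after-pop c c<sP with <-cmp c a
    ... | tri< c<a _ _ = ≤-trans (closed c c<a) (m≤n⇒m≤1+n (pop-≥ e a))
    ... | tri≈ _ refl _ = ≤-refl
    ... | tri> _ _ a<c = s≤s (≤-trans (pop-≤ e c (≤-bracket c c<n)) (pop-closed e a c a<c (s≤s⁻¹ c<sP)))
      where
      c<n : c < suc m
      c<n = ≤-<-trans (s≤s⁻¹ c<sP) (≤-<-trans (pop-≤ e a (≤-bracket a a<n)) (bracket-< a a<n))
    -- A closed [a, u] beyond P would contain suc P, whose raised bracket is already m > u.
    maximal : ∀ u → a ≤ u → u < raised a → Closed raised a u → u ≤ P
    maximal u a≤u u<ra closed-u with u ≤? P
    ... | yes u≤P = u≤P
    ... | no u≰P = contradiction (closed-u (suc P) (s≤s (pop-≥ e a)) (≰⇒> u≰P))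
      (<⇒≱ (subst (u <_) (trans (raised-closed a closed) (sym (raised-closed (suc P) closed-after-pop))) u<ra))

  pop-raised : ∀ a → a < suc m → pop raised a ≡ pop e a
  pop-raised a a<n = [ pop-raised-closed a a<n , pop-raised-open a a<n ]′ (toSum (popClosed? a))

  raised-zero : raised 0 ≡ m
  raised-zero = raised-closed 0 (λ _ ())

lookup-last : ∀ {m e} (B : IsBracket (suc m) e) → e 0 ≡ m → lookup (FromBracket.word B) (fromℕ m) ≡ zero
lookup-last {m} {e} B e0≡m = trans (cong (lookup word) (sym place-zero)) (lookup-place zero)
  where
  open FromBracket B
  place-zero : place zero ≡ fromℕ m
  place-zero = toℕ-injective (begin
    toℕ (place zero)  ≡⟨ toℕ-place zero ⟩
    e 0 + 0           ≡⟨ +-identityʳ (e 0) ⟩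
    e 0               ≡⟨ e0≡m ⟩
    m                 ≡⟨ toℕ-fromℕ m ⟨
    toℕ (fromℕ m)     ∎)
    where open ≡-Reasoning

IsMeetT-cong : ∀ {n} {S S′ : Word n → Set} {x : Word n} →
  (∀ w → Tam w → LowerBound S w ⇔ LowerBound S′ w) → IsMeetT S x → IsMeetT S′ x
IsMeetT-cong {x = x} same (tamX , lowerX , greatestX) = tamX , Equivalence.to (same x tamX) lowerX ,
  λ w tamW lowerW → greatestX w tamW (Equivalence.from (same w tamW) lowerW)

mainTheorem16 : (m : ℕ) (x : Word (suc m)) →
    Σ (Word (suc m)) (λ z → Tam z × IsPop z x) →
    Σ (Word (suc m)) (λ y → Tam y × lookup y (fromℕ m) ≡ zero × IsPop y x)
mainTheorem16 m x (z , tamZ , popZ) =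
  y , tamY , lookup-last raised-isBracket raised-zero , IsMeetT-cong {x = x} sameLowerBounds popZ
  where
  Z = TamBracket.isBracketOf z tamZ
  open Raise m (IsBracketOf.isBracket Z)
  open FromBracket raised-isBracket using () renaming (word to y; tam to tamY; isBracketOf to Y)
  sameLowerBounds : ∀ w → Tam w → LowerBound (PopSet z) w ⇔ LowerBound (PopSet y) w
  sameLowerBounds w tamW = ⇔-sym (Covers.lowerBound⇔≤pop tamY Y W)
    ⇔-∘ (≤[]-congʳ (λ a a<n → sym (pop-raised a a<n)) ⇔-∘ Covers.lowerBound⇔≤pop tamZ Z W)
    where
    W = TamBracket.isBracketOf w tamW
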